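{- Let $G$ be a finite group and $H$ a normal subgroup of $G$. Say that $H$ satisfies property (P) if for every $g\in G$ with $g^2\in H$ there exists $h\in H$ such that $(gh)^2=e$. Then: (a) $H$ is a perfect code of $G$ if and only if $H$ satisfies (P). (b) $H$ is a total perfect code of $G$ if and only if $|H|$ is even and $H$ satisfies (P).
   Context: All groups and graphs are finite; $e$ denotes the identity of $G$. For $S\subseteq G$ with $e\notin S$ and $S^{ -1}=S$, the Cayley graph $\mathrm{Cay}(G,S)$ has vertex set $G$, with $x,y$ adjacent iff $yx^{ -1}\in S$. A subset $C$ of the vertex set of a graph is a perfect code if every vertex is at distance at most one from exactly one vertex of $C$; it is a total perfect code if every vertex has exactly one neighbour in $C$. A subset $C\subseteq G$ is called a perfect code (resp. total perfect code) of $G$ if it is a perfect code (resp. total perfect code) in some Cayley graph $\mathrm{Cay}(G,S)$ of $G$. -}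

module Defs where

open import Data.Nat using (ℕ)
open import Data.Fin using (Fin)
open import Data.Fin.Subset using (Subset; _∈_; _∉_)
open import Data.Product using (Σ; _×_; _,_)
open import Data.Sum using (_⊎_)
open import Relation.Binary.PropositionalEquality using (_≡_)
open import Algebra.Structures using (IsGroup)

-- A finite group of order n, presented on the carrier Fin n
-- (every finite group is isomorphic to one of this form).
record FinGroup (n : ℕ) : Set where
  field
    _∙_     : Fin n → Fin n → Fin n
    e       : Fin n
    _⁻¹     : Fin n → Fin n
    isGroup : IsGroup (_≡_ {A = Fin n}) _∙_ e _⁻¹
  infixl 7 _∙_
  infix 8 _⁻¹

module _ {n : ℕ} (G : FinGroup n) where
  open FinGroup G

  IsNormalSubgroup : Subset n → Set
  IsNormalSubgroup H =
    (e ∈ H)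
    × (∀ x y → x ∈ H → y ∈ H → (x ∙ y) ∈ H)
    × (∀ x → x ∈ H → (x ⁻¹) ∈ H)
    × (∀ g x → x ∈ H → (g ∙ x ∙ g ⁻¹) ∈ H)

  IsConnectionSet : Subset n → Set
  IsConnectionSet S = (e ∉ S) × (∀ x → x ∈ S → (x ⁻¹) ∈ S)

  Adj : Subset n → Fin n → Fin n → Set
  Adj S x y = (y ∙ x ⁻¹) ∈ S

  Close : Subset n → Fin n → Fin n → Set
  Close S x y = (x ≡ y) ⊎ Adj S x y

  ExactlyOne : Subset n → (Fin n → Set) → Set
  ExactlyOne C R = Σ (Fin n) λ c → (c ∈ C) × R c × (∀ c' → c' ∈ C → R c' → c' ≡ c)

  PerfectCodeIn : Subset n → Subset n → Set
  PerfectCodeIn S C = ∀ x → ExactlyOne C (Close S x)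

  TotalPerfectCodeIn : Subset n → Subset n → Set
  TotalPerfectCodeIn S C = ∀ x → ExactlyOne C (Adj S x)

  IsPerfectCode : Subset n → Set
  IsPerfectCode C = Σ (Subset n) λ S → IsConnectionSet S × PerfectCodeIn S C

  IsTotalPerfectCode : Subset n → Set
  IsTotalPerfectCode C = Σ (Subset n) λ S → IsConnectionSet S × TotalPerfectCodeIn S C

  PropertyP : Subset n → Set
  PropertyP H = ∀ g → (g ∙ g) ∈ H →
    Σ (Fin n) λ h → (h ∈ H) × ((g ∙ h) ∙ (g ∙ h) ≡ e)

module Submission where

-- For a normal subgroup H, the elements c ∈ H adjacent to v in Cay(G,S) are those with c v⁻¹ ∈ S,
-- and these c v⁻¹ run through the coset H v⁻¹.  So H is a perfect (total perfect) code iff some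
-- inverse-closed S ∌ e meets every coset but H (every coset) in exactly one point.  When x² ∈ H,
-- i.e. Hx = Hx⁻¹, that point must be an involution: (P) supplies one for x ∉ H, and H contains
-- one iff |H| is even (x ↦ x⁻¹, resp. x ↦ x t, pairs off the elements of H).  Such an S is made
-- canonical by taking the least admissible element of each pair {Hx, Hx⁻¹} and its inverse.
-- Conversely, if c is the only neighbour of g in H and g² ∈ H, then g c⁻¹ g is another one, so
-- (g c⁻¹)² = e.

open import Defs
open import Algebra.Bundles using (Group)
import Algebra.Properties.Group as GroupProperties
import Algebra.Properties.Monoid as MonoidProperties
open import Data.Empty using (⊥-elim)
open import Data.Fin using (Fin; zero; suc; _<_)
open import Data.Fin.Properties using (all?; any?; _≟_; _<?_; <-cmp)
open import Data.Fin.Subset using (Subset; _∈_; _∉_; ∣_∣; _-_; inside; outside)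
open import Data.Fin.Subset.Properties
  using (_∈?_; nonempty?; Empty-unique; ∣⊥∣≡0; p─⊥≡p; p─q⊆p; x∈p∧x≢y⇒x∈p-y; x∈p⇒∣p-x∣<∣p∣)
open import Data.Nat using (ℕ; _+_; s≤s)
import Data.Nat as ℕ
open import Data.Nat.Divisibility using (_∣_; _∣0; ∣m+n∣m⇒∣n; ∣1⇒≡1; ∣-refl; ∣m∣n⇒∣m+n)
open import Data.Nat.Induction using (<-wellFounded)
open import Data.Nat.Properties using (<-trans; +-comm)
open import Data.Product using (Σ; _×_; _,_; proj₁; proj₂; uncurry)
open import Data.Sum using (_⊎_; inj₁; inj₂)
open import Data.Vec using (_∷_; here; there; tabulate)
open import Data.Vec.Properties using (lookup∘tabulate; []=⇒lookup; lookup⇒[]=)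
open import Function.Bundles using (_⇔_; mk⇔)
open import Induction.WellFounded using (Acc; acc)
open import Relation.Binary.Definitions using (tri<; tri≈; tri>)
open import Relation.Binary.PropositionalEquality
open import Relation.Nullary using (¬_; yes; no; does; contradiction)
open import Relation.Nullary.Decidable using (_×-dec_; _⊎-dec_; _→-dec_; ¬?; dec-true)
open import Relation.Unary using (Decidable; Satisfiable; _⊆_; _≐_)

x∈p⇒∣p∣≡1+∣p-x∣ : ∀ {n} {p : Subset n} {x} → x ∈ p → ∣ p ∣ ≡ 1 + ∣ p - x ∣
x∈p⇒∣p∣≡1+∣p-x∣ {p = inside ∷ p} here = cong (1 +_) (sym (cong ∣_∣ (p─⊥≡p p)))
x∈p⇒∣p∣≡1+∣p-x∣ {p = inside ∷ p} (there x∈p) = cong (1 +_) (x∈p⇒∣p∣≡1+∣p-x∣ x∈p)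
x∈p⇒∣p∣≡1+∣p-x∣ {p = outside ∷ p} (there x∈p) = x∈p⇒∣p∣≡1+∣p-x∣ x∈p

x∈p-y⇒x≢y : ∀ {n} {p : Subset n} {x y} → x ∈ p - y → x ≢ y
x∈p-y⇒x≢y {p = _ ∷ p} {y = zero} (there x∈p-y) ()
x∈p-y⇒x≢y {p = _ ∷ p} {y = suc y} (there x∈p-y) refl = x∈p-y⇒x≢y x∈p-y refl

x∈p-y⁻ : ∀ {n} {p : Subset n} {x y} → x ∈ p - y → x ∈ p × x ≢ y
x∈p-y⁻ {p = p} x∈p-y = p─q⊆p p _ x∈p-y , x∈p-y⇒x≢y x∈p-y

module _ {n} (f : Fin n → Fin n) (f-involutive : ∀ x → f (f x) ≡ x) where

  ClosedUnder : Subset n → Set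
  ClosedUnder p = ∀ {x} → x ∈ p → f x ∈ p

  FixedPointFreeOn : Subset n → Set
  FixedPointFreeOn p = ∀ {x} → x ∈ p → f x ≢ x

  private
    f-injective : ∀ {x y} → f x ≡ f y → x ≡ y
    f-injective {x} {y} eq = trans (sym (f-involutive x)) (trans (cong f eq) (f-involutive y))

  remove-fixedPoint : ∀ {p a} → ClosedUnder p → f a ≡ a → ClosedUnder (p - a)
  remove-fixedPoint closed fa≡a x∈p-a with x∈p-y⁻ x∈p-a
  ... | x∈p , x≢a = x∈p∧x≢y⇒x∈p-y (closed x∈p) λ fx≡a → x≢a (f-injective (trans fx≡a (sym fa≡a)))

  remove-orbit : ∀ {p x} → ClosedUnder p → x ∈ p → f x ≢ x →
    ∣ p ∣ ≡ 2 + ∣ p - x - f x ∣ × ∣ p - x - f x ∣ ℕ.< ∣ p ∣ × ClosedUnder (p - x - f x)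
  remove-orbit {p} {x} closed x∈p fx≢x =
    card , <-trans (x∈p⇒∣p-x∣<∣p∣ fx∈p-x) (x∈p⇒∣p-x∣<∣p∣ x∈p) , closed'
    where
    fx∈p-x : f x ∈ p - x
    fx∈p-x = x∈p∧x≢y⇒x∈p-y (closed x∈p) fx≢x
    card : ∣ p ∣ ≡ 2 + ∣ p - x - f x ∣
    card = trans (x∈p⇒∣p∣≡1+∣p-x∣ x∈p) (cong (1 +_) (x∈p⇒∣p∣≡1+∣p-x∣ fx∈p-x))
    closed' : ClosedUnder (p - x - f x)
    closed' {y} y∈ with x∈p-y⁻ y∈
    ... | y∈p-x , y≢fx with x∈p-y⁻ y∈p-x
    ... | y∈p , y≢x =
      x∈p∧x≢y⇒x∈p-y
        (x∈p∧x≢y⇒x∈p-y (closed y∈p) λ fy≡x → y≢fx (trans (sym (f-involutive y)) (cong f fy≡x)))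
        λ fy≡fx → y≢x (f-injective fy≡fx)

  even-if-fixedPointFree : ∀ {p} → ClosedUnder p → FixedPointFreeOn p → 2 ∣ ∣ p ∣
  even-if-fixedPointFree {p} = go (<-wellFounded ∣ p ∣)
    where
    go : ∀ {p} → Acc ℕ._<_ ∣ p ∣ → ClosedUnder p → FixedPointFreeOn p → 2 ∣ ∣ p ∣
    go {p} (acc smaller) closed free with nonempty? p
    ... | no ¬nonempty = subst (2 ∣_) (sym (trans (cong ∣_∣ (Empty-unique ¬nonempty)) (∣⊥∣≡0 n))) (2 ∣0)
    ... | yes (x , x∈p) with remove-orbit closed x∈p (free x∈p)
    ... | ∣p∣≡2+∣p'∣ , ∣p'∣<∣p∣ , closed' =
      subst (2 ∣_) (sym ∣p∣≡2+∣p'∣)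
        (∣m∣n⇒∣m+n ∣-refl (go (smaller ∣p'∣<∣p∣) closed'
          λ y∈ → free (proj₁ (x∈p-y⁻ (proj₁ (x∈p-y⁻ y∈))))))

  odd-if-uniqueFixedPoint : ∀ {p a} → ClosedUnder p → a ∈ p → f a ≡ a →
    (∀ {x} → x ∈ p → f x ≡ x → x ≡ a) → ¬ 2 ∣ ∣ p ∣
  odd-if-uniqueFixedPoint {p} {a} closed a∈p fa≡a unique 2∣∣p∣ =
    contradiction (∣1⇒≡1 (∣m+n∣m⇒∣n 2∣∣p-a∣+1 2∣∣p-a∣)) λ ()
    where
    2∣∣p-a∣+1 : 2 ∣ ∣ p - a ∣ + 1
    2∣∣p-a∣+1 = subst (2 ∣_) (trans (x∈p⇒∣p∣≡1+∣p-x∣ a∈p) (+-comm 1 _)) 2∣∣p∣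
    2∣∣p-a∣ : 2 ∣ ∣ p - a ∣
    2∣∣p-a∣ = even-if-fixedPointFree (remove-fixedPoint closed fa≡a)
      λ x∈p-a fx≡x → let x∈p , x≢a = x∈p-y⁻ x∈p-a in x≢a (unique x∈p fx≡x)

Least : ∀ {n} → (Fin n → Set) → Fin n → Set
Least P y = P y × (∀ z → z < y → ¬ P z)

least : ∀ {n} {P : Fin n → Set} → Decidable P → Satisfiable P → Satisfiable (Least P)
least P? (zero , P0) = zero , P0 , λ _ ()
least P? (suc y , Py) with P? zero
... | yes P0 = zero , P0 , λ _ ()
... | no ¬P0 with least (λ z → P? (suc z)) (y , Py)
...   | m , Pm , m-least = suc m , Pm , λ where
  zero _ → ¬P0
  (suc z) (s≤s z<m) → m-least z z<m

module _ {n} {P : Fin n → Set} where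

  Least-unique : ∀ {a b} → Least P a → Least P b → a ≡ b
  Least-unique {a} {b} (Pa , a-least) (Pb , b-least) with <-cmp a b
  ... | tri< a<b _ _ = ⊥-elim (b-least a a<b Pa)
  ... | tri≈ _ a≡b _ = a≡b
  ... | tri> _ _ b<a = ⊥-elim (a-least b b<a Pb)

  Least-cong : ∀ {Q} → P ≐ Q → Least P ⊆ Least Q
  Least-cong (P⊆Q , Q⊆P) (Py , y-least) = P⊆Q Py , λ z z<y Qz → y-least z z<y (Q⊆P Qz)

  Least? : Decidable P → Decidable (Least P)
  Least? P? y = P? y ×-dec all? (λ z → z <? y →-dec ¬? (P? z))

toSubset : ∀ {n} {P : Fin n → Set} → Decidable P → Subset n
toSubset P? = tabulate (λ x → does (P? x))

module _ {n} {P : Fin n → Set} (P? : Decidable P) where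

  ∈toSubset⁺ : ∀ {x} → P x → x ∈ toSubset P?
  ∈toSubset⁺ {x} Px = lookup⇒[]= x _ (trans (lookup∘tabulate _ x) (dec-true (P? x) Px))

  ∈toSubset⁻ : ∀ {x} → x ∈ toSubset P? → P x
  ∈toSubset⁻ {x} x∈ with P? x | trans (sym (lookup∘tabulate (λ y → does (P? y)) x)) ([]=⇒lookup x∈)
  ... | yes Px | _ = Px
  ... | no _ | ()

module FinGroupProperties {n : ℕ} (G : FinGroup n) where
  open FinGroup G

  group : Group _ _
  group = record { isGroup = isGroup }

  open Group group public using (assoc; identityʳ; inverseˡ; inverseʳ)
  open GroupProperties group public
    using (⁻¹-involutive; ε⁻¹≈ε; ⁻¹-anti-homo-∙; ∙-cancelˡ; ∙-cancelʳ; inverseˡ-unique)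
  open MonoidProperties (Group.monoid group) using (cancelʳ)

  x∙y⁻¹∙y≡x : ∀ x y → x ∙ y ⁻¹ ∙ y ≡ x
  x∙y⁻¹∙y≡x x y = cancelʳ (inverseˡ y) x

  x∙y∙y⁻¹≡x : ∀ x y → x ∙ y ∙ y ⁻¹ ≡ x
  x∙y∙y⁻¹≡x x y = cancelʳ (inverseʳ y) x

  [x∙y⁻¹]⁻¹≡y∙x⁻¹ : ∀ x y → (x ∙ y ⁻¹) ⁻¹ ≡ y ∙ x ⁻¹
  [x∙y⁻¹]⁻¹≡y∙x⁻¹ x y = trans (⁻¹-anti-homo-∙ x (y ⁻¹)) (cong (_∙ x ⁻¹) (⁻¹-involutive y))

module Cosets {n : ℕ} (G : FinGroup n) {H : Subset n} (N : IsNormalSubgroup G H) where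
  open FinGroup G
  open FinGroupProperties G
  open ≡-Reasoning

  e∈H : e ∈ H
  e∈H = proj₁ N

  ∙-closed : ∀ {x y} → x ∈ H → y ∈ H → (x ∙ y) ∈ H
  ∙-closed = proj₁ (proj₂ N) _ _

  ⁻¹-closed : ∀ {x} → x ∈ H → (x ⁻¹) ∈ H
  ⁻¹-closed = proj₁ (proj₂ (proj₂ N)) _

  conj-closed : ∀ g {x} → x ∈ H → (g ∙ x ∙ g ⁻¹) ∈ H
  conj-closed g = proj₂ (proj₂ (proj₂ N)) g _

  ⁻¹-closed⁻ : ∀ {x} → (x ⁻¹) ∈ H → x ∈ H
  ⁻¹-closed⁻ {x} x⁻¹∈H = subst (_∈ H) (⁻¹-involutive x) (⁻¹-closed x⁻¹∈H)

  infix 4 _~_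
  _~_ : Fin n → Fin n → Set
  x ~ y = (x ∙ y ⁻¹) ∈ H

  ~-refl : ∀ {x} → x ~ x
  ~-refl {x} = subst (_∈ H) (sym (inverseʳ x)) e∈H

  ~-sym : ∀ {x y} → x ~ y → y ~ x
  ~-sym {x} {y} x~y = subst (_∈ H) ([x∙y⁻¹]⁻¹≡y∙x⁻¹ x y) (⁻¹-closed x~y)

  ~-trans : ∀ {x y z} → x ~ y → y ~ z → x ~ z
  ~-trans {x} {y} {z} x~y y~z = subst (_∈ H) eq (∙-closed x~y y~z)
    where
    eq : x ∙ y ⁻¹ ∙ (y ∙ z ⁻¹) ≡ x ∙ z ⁻¹
    eq = trans (sym (assoc _ y _)) (cong (_∙ z ⁻¹) (x∙y⁻¹∙y≡x x y))

  ~-∙ʳ : ∀ {x y} z → x ~ y → (x ∙ z) ~ (y ∙ z)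
  ~-∙ʳ {x} {y} z x~y = subst (_∈ H) eq x~y
    where
    eq : x ∙ y ⁻¹ ≡ x ∙ z ∙ (y ∙ z) ⁻¹
    eq = begin
      x ∙ y ⁻¹                ≡⟨ cong (_∙ y ⁻¹) (x∙y∙y⁻¹≡x x z) ⟨
      x ∙ z ∙ z ⁻¹ ∙ y ⁻¹     ≡⟨ assoc _ _ _ ⟩
      x ∙ z ∙ (z ⁻¹ ∙ y ⁻¹)   ≡⟨ cong (x ∙ z ∙_) (⁻¹-anti-homo-∙ y z) ⟨
      x ∙ z ∙ (y ∙ z) ⁻¹      ∎

  ~-⁻¹ : ∀ {x y} → x ~ y → x ⁻¹ ~ y ⁻¹
  ~-⁻¹ {x} {y} x~y = subst (_∈ H) eq (conj-closed (x ⁻¹) (~-sym x~y))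
    where
    eq : x ⁻¹ ∙ (y ∙ x ⁻¹) ∙ x ⁻¹ ⁻¹ ≡ x ⁻¹ ∙ y ⁻¹ ⁻¹
    eq = begin
      x ⁻¹ ∙ (y ∙ x ⁻¹) ∙ x ⁻¹ ⁻¹  ≡⟨ cong (_∙ x ⁻¹ ⁻¹) (assoc _ _ _) ⟨
      x ⁻¹ ∙ y ∙ x ⁻¹ ∙ x ⁻¹ ⁻¹    ≡⟨ x∙y∙y⁻¹≡x _ (x ⁻¹) ⟩
      x ⁻¹ ∙ y                     ≡⟨ cong (x ⁻¹ ∙_) (⁻¹-involutive y) ⟨
      x ⁻¹ ∙ y ⁻¹ ⁻¹               ∎

  ~-⁻¹ˡ : ∀ {x y} → x ~ y ⁻¹ → x ⁻¹ ~ y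
  ~-⁻¹ˡ {y = y} x~y⁻¹ = subst (λ z → _ ~ z) (⁻¹-involutive y) (~-⁻¹ x~y⁻¹)

  ~-of-∈H : ∀ {x y} → x ∈ H → y ∈ H → x ~ y
  ~-of-∈H x∈H y∈H = ∙-closed x∈H (⁻¹-closed y∈H)

  ∈H-resp-~ : ∀ {x y} → x ~ y → y ∈ H → x ∈ H
  ∈H-resp-~ {x} {y} x~y y∈H = subst (_∈ H) (x∙y⁻¹∙y≡x x y) (∙-closed x~y y∈H)

  -- g c⁻¹ g lies in H (as g² does) and is adjacent to g as well, so it is c.
  unique-neighbour-square : ∀ {S} → (∀ x → x ∈ S → (x ⁻¹) ∈ S) → ∀ {g c} → (g ∙ g) ∈ H →
    c ∈ H → Adj G S g c → (∀ {c'} → c' ∈ H → Adj G S g c' → c' ≡ c) →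
    (g ∙ c ⁻¹) ∙ (g ∙ c ⁻¹) ≡ e
  unique-neighbour-square {S} S⁻¹⊆S {g} {c} g²∈H c∈H g—c unique = begin
    (g ∙ c ⁻¹) ∙ (g ∙ c ⁻¹)  ≡⟨ assoc _ _ _ ⟨
    g ∙ c ⁻¹ ∙ g ∙ c ⁻¹      ≡⟨ cong (_∙ c ⁻¹) (unique c'∈H g—c') ⟩
    c ∙ c ⁻¹                 ≡⟨ inverseʳ c ⟩
    e                        ∎
    where
    c'∈H : (g ∙ c ⁻¹ ∙ g) ∈ H
    c'∈H = subst (_∈ H) (trans (sym (assoc _ g g)) (cong (_∙ g) (x∙y⁻¹∙y≡x _ g)))
                 (∙-closed (conj-closed g (⁻¹-closed c∈H)) g²∈H)
    g—c' : Adj G S g (g ∙ c ⁻¹ ∙ g)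
    g—c' = subst (_∈ S) (trans ([x∙y⁻¹]⁻¹≡y∙x⁻¹ c g) (sym (x∙y∙y⁻¹≡x _ g))) (S⁻¹⊆S _ g—c)

  perfectCode⇒P : IsPerfectCode G H → PropertyP G H
  perfectCode⇒P (S , (_ , S⁻¹⊆S) , perfect) g g²∈H with perfect g
  ... | c , c∈H , inj₁ refl , _ =
    c ⁻¹ , ⁻¹-closed c∈H , trans (cong (λ z → z ∙ z) (inverseʳ c)) (identityʳ e)
  ... | c , c∈H , inj₂ g—c , unique =
    c ⁻¹ , ⁻¹-closed c∈H ,
    unique-neighbour-square S⁻¹⊆S g²∈H c∈H g—c (λ c'∈H g—c' → unique _ c'∈H (inj₂ g—c'))

  totalPerfectCode⇒P : IsTotalPerfectCode G H → PropertyP G H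
  totalPerfectCode⇒P (S , (_ , S⁻¹⊆S) , total) g g²∈H with total g
  ... | c , c∈H , g—c , unique =
    c ⁻¹ , ⁻¹-closed c∈H , unique-neighbour-square S⁻¹⊆S g²∈H c∈H g—c (unique _)

  involution⇒even-order : ∀ {t} → t ∈ H → t ≢ e → t ∙ t ≡ e → 2 ∣ ∣ H ∣
  involution⇒even-order {t} t∈H t≢e t∙t≡e =
    even-if-fixedPointFree (_∙ t) ∙t-involutive (λ x∈H → ∙-closed x∈H t∈H) ∙t-fixedPointFree
    where
    ∙t-involutive : ∀ x → x ∙ t ∙ t ≡ x
    ∙t-involutive x = trans (assoc x t t) (trans (cong (x ∙_) t∙t≡e) (identityʳ x))
    ∙t-fixedPointFree : ∀ {x} → x ∈ H → x ∙ t ≢ x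
    ∙t-fixedPointFree {x} _ x∙t≡x = t≢e (∙-cancelˡ x t e (trans x∙t≡x (sym (identityʳ x))))

  even-order⇒involution : 2 ∣ ∣ H ∣ → Σ (Fin n) λ t → t ∈ H × t ≢ e × t ∙ t ≡ e
  even-order⇒involution 2∣∣H∣ with any? (λ t → t ∈? H ×-dec ¬? (t ≟ e) ×-dec (t ∙ t ≟ e))
  ... | yes involution = involution
  ... | no ¬involution =
    ⊥-elim (odd-if-uniqueFixedPoint _⁻¹ ⁻¹-involutive ⁻¹-closed e∈H ε⁻¹≈ε only-e 2∣∣H∣)
    where
    only-e : ∀ {x} → x ∈ H → x ⁻¹ ≡ x → x ≡ e
    only-e {x} x∈H x⁻¹≡x with x ≟ e
    ... | yes x≡e = x≡e
    ... | no x≢e = ⊥-elim (¬involution (x , x∈H , x≢e , trans (cong (x ∙_) (sym x⁻¹≡x)) (inverseʳ x)))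

  -- The unique element of H adjacent to e is an involution different from e.
  totalPerfectCode⇒even : IsTotalPerfectCode G H → 2 ∣ ∣ H ∣
  totalPerfectCode⇒even (S , (e∉S , S⁻¹⊆S) , total) with total e
  ... | c , c∈H , e—c , unique = involution⇒even-order c∈H (λ c≡e → e∉S (subst (_∈ S) c≡e c∈S)) c∙c≡e
    where
    x∙e⁻¹≡x : ∀ x → x ∙ e ⁻¹ ≡ x
    x∙e⁻¹≡x x = trans (cong (x ∙_) ε⁻¹≈ε) (identityʳ x)
    c∈S : c ∈ S
    c∈S = subst (_∈ S) (x∙e⁻¹≡x c) e—c
    c⁻¹≡c : c ⁻¹ ≡ c
    c⁻¹≡c = unique (c ⁻¹) (⁻¹-closed c∈H) (subst (_∈ S) (sym (x∙e⁻¹≡x (c ⁻¹))) (S⁻¹⊆S c c∈S))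
    c∙c≡e : c ∙ c ≡ e
    c∙c≡e = trans (cong (c ∙_) (sym c⁻¹≡c)) (inverseʳ c)

  OnePerCoset : Subset n → Set
  OnePerCoset S = ∀ {s s'} → s ∈ S → s' ∈ S → s ~ s' → s ≡ s'

  MeetsCosetOf : Subset n → Fin n → Set
  MeetsCosetOf S x = Σ (Fin n) λ s → s ∈ S × s ~ x

  -- The elements of H adjacent to v are the c with c v⁻¹ ∈ S, and all c v⁻¹ lie in the coset H v⁻¹.
  neighbour-unique : ∀ {S} → OnePerCoset S → ∀ {v c c'} → c ∈ H → c' ∈ H →
    Adj G S v c → Adj G S v c' → c' ≡ c
  neighbour-unique one {v} {c} {c'} c∈H c'∈H v—c v—c' =
    ∙-cancelʳ (v ⁻¹) c' c (one v—c' v—c (~-∙ʳ (v ⁻¹) (~-of-∈H c'∈H c∈H)))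

  neighbour-exists : ∀ {S v} → MeetsCosetOf S (v ⁻¹) → Σ (Fin n) λ c → c ∈ H × Adj G S v c
  neighbour-exists {S} {v} (s , s∈S , s~v⁻¹) =
    s ∙ v , subst (λ z → (s ∙ z) ∈ H) (⁻¹-involutive v) s~v⁻¹ , subst (_∈ S) (sym (x∙y∙y⁻¹≡x s v)) s∈S

  totalPerfectCode-of-transversal : ∀ {S} → OnePerCoset S → (∀ x → MeetsCosetOf S x) →
    TotalPerfectCodeIn G S H
  totalPerfectCode-of-transversal one meets v with neighbour-exists (meets (v ⁻¹))
  ... | c , c∈H , v—c = c , c∈H , v—c , λ _ c'∈H v—c' → neighbour-unique one c∈H c'∈H v—c v—c'

  perfectCode-of-transversal : ∀ {S} → OnePerCoset S → (∀ {s} → s ∈ S → s ∉ H) →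
    (∀ x → x ∉ H → MeetsCosetOf S x) → PerfectCodeIn G S H
  perfectCode-of-transversal {S} one S∩H≡∅ meets v with v ∈? H
  ... | yes v∈H = v , v∈H , inj₁ refl , unique
    where
    unique : ∀ c' → c' ∈ H → Close G S v c' → c' ≡ v
    unique c' _ (inj₁ v≡c') = sym v≡c'
    unique c' c'∈H (inj₂ v—c') = ⊥-elim (S∩H≡∅ v—c' (~-of-∈H c'∈H v∈H))
  ... | no v∉H with neighbour-exists (meets (v ⁻¹) (λ v⁻¹∈H → v∉H (⁻¹-closed⁻ v⁻¹∈H)))
  ...   | c , c∈H , v—c = c , c∈H , inj₂ v—c , unique
    where
    unique : ∀ c' → c' ∈ H → Close G S v c' → c' ≡ c
    unique c' c'∈H (inj₁ refl) = ⊥-elim (v∉H c'∈H)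
    unique c' c'∈H (inj₂ v—c') = neighbour-unique one c∈H c'∈H v—c v—c'

  Paired : Fin n → Fin n → Set
  Paired x y = y ~ x ⊎ y ~ x ⁻¹

  Paired-sym : ∀ {x y} → Paired x y → Paired y x
  Paired-sym (inj₁ y~x) = inj₁ (~-sym y~x)
  Paired-sym (inj₂ y~x⁻¹) = inj₂ (~-sym (~-⁻¹ˡ y~x⁻¹))

  Paired-trans : ∀ {x y z} → Paired x y → Paired y z → Paired x z
  Paired-trans (inj₁ y~x) (inj₁ z~y) = inj₁ (~-trans z~y y~x)
  Paired-trans (inj₁ y~x) (inj₂ z~y⁻¹) = inj₂ (~-trans z~y⁻¹ (~-⁻¹ y~x))
  Paired-trans (inj₂ y~x⁻¹) (inj₁ z~y) = inj₂ (~-trans z~y y~x⁻¹)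
  Paired-trans (inj₂ y~x⁻¹) (inj₂ z~y⁻¹) = inj₁ (~-trans z~y⁻¹ (~-⁻¹ˡ y~x⁻¹))

  Paired-⁻¹ : ∀ x → Paired x (x ⁻¹)
  Paired-⁻¹ x = inj₂ ~-refl

  -- In a coset with Hy = Hy⁻¹ only involutions are admissible, so that S can meet it once
  -- and still be closed under inverses.
  Admissible : Fin n → Set
  Admissible y = ((y ∙ y) ∈ H → y ∙ y ≡ e) × y ≢ e

  Candidate : Fin n → Fin n → Set
  Candidate x y = Paired x y × Admissible y

  Candidate? : ∀ x → Decidable (Candidate x)
  Candidate? x y = ((y ∙ x ⁻¹) ∈? H ⊎-dec (y ∙ x ⁻¹ ⁻¹) ∈? H)
    ×-dec (((y ∙ y) ∈? H →-dec (y ∙ y ≟ e)) ×-dec ¬? (y ≟ e))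

  Candidate-cong : ∀ {x y} → Paired x y → Candidate x ≐ Candidate y
  Candidate-cong x≈y = (λ (x≈z , z-ok) → Paired-trans (Paired-sym x≈y) x≈z , z-ok)
                     , (λ (y≈z , z-ok) → Paired-trans x≈y y≈z , z-ok)

  Selected : Fin n → Set
  Selected x = Least (Candidate x) x ⊎ Least (Candidate x) (x ⁻¹)

  Selected? : Decidable Selected
  Selected? x = Least? (Candidate? x) x ⊎-dec Least? (Candidate? x) (x ⁻¹)

  Selected-⁻¹ : ∀ {x} → Selected x → Selected (x ⁻¹)
  Selected-⁻¹ {x} (inj₁ least-x) =
    inj₂ (subst (Least _) (sym (⁻¹-involutive x)) (Least-cong (Candidate-cong (Paired-⁻¹ x)) least-x))
  Selected-⁻¹ {x} (inj₂ least-x⁻¹) = inj₁ (Least-cong (Candidate-cong (Paired-⁻¹ x)) least-x⁻¹)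

  Selected⇒≢e : ∀ {x} → Selected x → x ≢ e
  Selected⇒≢e (inj₁ ((_ , _ , x≢e) , _)) = x≢e
  Selected⇒≢e (inj₂ ((_ , _ , x⁻¹≢e) , _)) refl = x⁻¹≢e ε⁻¹≈ε

  Selected⇒least : ∀ {x} → Selected x → Σ (Fin n) λ m → Least (Candidate x) m × (x ≡ m ⊎ x ≡ m ⁻¹)
  Selected⇒least {x} (inj₁ least-x) = x , least-x , inj₁ refl
  Selected⇒least {x} (inj₂ least-x⁻¹) = x ⁻¹ , least-x⁻¹ , inj₂ (sym (⁻¹-involutive x))

  selfPaired⇒involution : ∀ {m} → Admissible m → m ~ m ⁻¹ → m ⁻¹ ≡ m
  selfPaired⇒involution {m} (m²∈H⇒m²≡e , _) m~m⁻¹ =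
    sym (inverseˡ-unique m m (m²∈H⇒m²≡e (subst (λ z → (m ∙ z) ∈ H) (⁻¹-involutive m) m~m⁻¹)))

  Selected-unique : ∀ {x x'} → Selected x → Selected x' → x ~ x' → x ≡ x'
  Selected-unique selected-x selected-x' x~x'
    with Selected⇒least selected-x | Selected⇒least selected-x'
  ... | m , least-m , x∈m±1 | m' , least-m' , x'∈m'±1
    with Least-unique (Least-cong (Candidate-cong (inj₁ x~x')) least-m') least-m
  ... | refl = same-pair x∈m±1 x'∈m'±1 x~x'
    where
    m-ok : Admissible m
    m-ok = proj₂ (proj₁ least-m)
    same-pair : ∀ {x x'} → x ≡ m ⊎ x ≡ m ⁻¹ → x' ≡ m ⊎ x' ≡ m ⁻¹ → x ~ x' → x ≡ x'
    same-pair (inj₁ refl) (inj₁ refl) _ = refl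
    same-pair (inj₁ refl) (inj₂ refl) m~m⁻¹ = sym (selfPaired⇒involution m-ok m~m⁻¹)
    same-pair (inj₂ refl) (inj₁ refl) m⁻¹~m = selfPaired⇒involution m-ok (~-sym m⁻¹~m)
    same-pair (inj₂ refl) (inj₂ refl) _ = refl

  Selected-exists : ∀ {x₀ y} → Candidate x₀ y → Σ (Fin n) λ x → x ~ x₀ × Selected x
  Selected-exists {x₀} x₀≈y with least (Candidate? x₀) (_ , x₀≈y)
  ... | m , least-m@((x₀≈m , _) , _) = from-pair x₀≈m
    where
    selected-m : Selected m
    selected-m = inj₁ (Least-cong (Candidate-cong x₀≈m) least-m)
    from-pair : Paired x₀ m → Σ (Fin n) λ x → x ~ x₀ × Selected x
    from-pair (inj₁ m~x₀) = m , m~x₀ , selected-m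
    from-pair (inj₂ m~x₀⁻¹) = m ⁻¹ , ~-⁻¹ˡ m~x₀⁻¹ , Selected-⁻¹ selected-m

  P⇒candidate : PropertyP G H → ∀ {x} → x ∉ H → Σ (Fin n) (Candidate x)
  P⇒candidate P {x} x∉H with (x ∙ x) ∈? H
  ... | no x²∉H = x , inj₁ ~-refl , (λ x²∈H → ⊥-elim (x²∉H x²∈H)) , λ { refl → x∉H e∈H }
  ... | yes x²∈H with P x x²∈H
  ...   | h , h∈H , [xh]²≡e = x ∙ h , inj₁ (conj-closed x h∈H) , (λ _ → [xh]²≡e) , xh≢e
    where
    xh≢e : x ∙ h ≢ e
    xh≢e xh≡e = x∉H (subst (_∈ H) (sym (inverseˡ-unique x h xh≡e)) (⁻¹-closed h∈H))

  P⇒perfectCode : PropertyP G H → IsPerfectCode G H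
  P⇒perfectCode P = S , (e∉S , S⁻¹⊆S) , perfectCode-of-transversal one (λ s∈S → proj₁ (∈S⁻ s∈S)) meets
    where
    Generator : Fin n → Set
    Generator x = x ∉ H × Selected x
    Generator? : Decidable Generator
    Generator? x = ¬? (x ∈? H) ×-dec Selected? x
    S : Subset n
    S = toSubset Generator?
    ∈S⁻ : ∀ {x} → x ∈ S → Generator x
    ∈S⁻ = ∈toSubset⁻ Generator?
    ∈S⁺ : ∀ {x} → Generator x → x ∈ S
    ∈S⁺ = ∈toSubset⁺ Generator?
    e∉S : e ∉ S
    e∉S e∈S = proj₁ (∈S⁻ e∈S) e∈H
    S⁻¹⊆S : ∀ x → x ∈ S → (x ⁻¹) ∈ S
    S⁻¹⊆S x x∈S with ∈S⁻ x∈S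
    ... | x∉H , selected-x = ∈S⁺ ((λ x⁻¹∈H → x∉H (⁻¹-closed⁻ x⁻¹∈H)) , Selected-⁻¹ selected-x)
    one : OnePerCoset S
    one s∈S s'∈S = Selected-unique (proj₂ (∈S⁻ s∈S)) (proj₂ (∈S⁻ s'∈S))
    meets : ∀ x → x ∉ H → MeetsCosetOf S x
    meets x x∉H with Selected-exists (proj₂ (P⇒candidate P x∉H))
    ... | s , s~x , selected-s = s , ∈S⁺ ((λ s∈H → x∉H (∈H-resp-~ (~-sym s~x) s∈H)) , selected-s) , s~x

  P⇒totalPerfectCode : 2 ∣ ∣ H ∣ → PropertyP G H → IsTotalPerfectCode G H
  P⇒totalPerfectCode 2∣∣H∣ P = S , (e∉S , S⁻¹⊆S) , totalPerfectCode-of-transversal one meets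
    where
    S : Subset n
    S = toSubset Selected?
    e∉S : e ∉ S
    e∉S e∈S = Selected⇒≢e (∈toSubset⁻ Selected? e∈S) refl
    S⁻¹⊆S : ∀ x → x ∈ S → (x ⁻¹) ∈ S
    S⁻¹⊆S x x∈S = ∈toSubset⁺ Selected? (Selected-⁻¹ (∈toSubset⁻ Selected? x∈S))
    one : OnePerCoset S
    one s∈S s'∈S = Selected-unique (∈toSubset⁻ Selected? s∈S) (∈toSubset⁻ Selected? s'∈S)
    candidate : ∀ x → Σ (Fin n) (Candidate x)
    candidate x with x ∈? H
    ... | no x∉H = P⇒candidate P x∉H
    ... | yes x∈H with even-order⇒involution 2∣∣H∣
    ...   | t , t∈H , t≢e , t²≡e = t , inj₁ (~-of-∈H t∈H x∈H) , (λ _ → t²≡e) , t≢e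
    meets : ∀ x → MeetsCosetOf S x
    meets x with Selected-exists (proj₂ (candidate x))
    ... | s , s~x , selected-s = s , ∈toSubset⁺ Selected? selected-s , s~x

theorem2p2 : {n : ℕ} (G : FinGroup n) (H : Subset n) → IsNormalSubgroup G H →
    (IsPerfectCode G H ⇔ PropertyP G H)
    × (IsTotalPerfectCode G H ⇔ ((2 ∣ ∣ H ∣) × PropertyP G H))
theorem2p2 G H N =
  mk⇔ perfectCode⇒P P⇒perfectCode ,
  mk⇔ (λ total → totalPerfectCode⇒even total , totalPerfectCode⇒P total) (uncurry P⇒totalPerfectCode)
  where open Cosets G N
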